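{- Let $G$ be a simple undirected graph, $H$ a set of edges between vertices of $G$ with $H\cap E(G)=\emptyset$, and $G'=G+H$. For $e\in H$ let $C'(e)$ be the set of maximal cliques of $G'$ containing both endpoints of $e$. Then \[\Lambda^{new}(G,G') = \bigcup_{e\in H} C'(e).\]
   Context: A clique is a set of pairwise adjacent vertices; it is maximal if not properly contained in another clique. $\mathcal{C}(G)$ is the set of maximal cliques of $G$; $G+H$ is the graph on $V(G)$ with edge set $E(G)\cup H$; $\Lambda^{new}(G,G')=\mathcal{C}(G')\setminus\mathcal{C}(G)$. -}

module Defs where

open import Level using (0ℓ)
open import Data.Nat using (ℕ)
open import Data.Fin using (Fin)
open import Data.Fin.Subset using (Subset; _∈_; _⊂_)
open import Data.Product using (_×_; ∃-syntax)
open import Data.Sum using (_⊎_)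
open import Relation.Nullary using (¬_; Dec)
open import Relation.Nullary.Decidable using (_⊎-dec_)
open import Relation.Binary.PropositionalEquality using (_≡_; _≢_)

record Graph (n : ℕ) : Set₁ where
  field
    Adj   : Fin n → Fin n → Set
    dec   : ∀ u v → Dec (Adj u v)
    sym   : ∀ {u v} → Adj u v → Adj v u
    irrefl : ∀ {u} → ¬ Adj u u
open Graph public

record EdgeSet (n : ℕ) : Set₁ where
  field
    Edge   : Fin n → Fin n → Set
    decE   : ∀ u v → Dec (Edge u v)
    symE   : ∀ {u v} → Edge u v → Edge v u
    irreflE : ∀ {u} → ¬ Edge u u
open EdgeSet public

Disjoint : ∀ {n} → Graph n → EdgeSet n → Set
Disjoint G H = ∀ u v → Edge H u v → ¬ Adj G u v

_+ᴱ_ : ∀ {n} → Graph n → EdgeSet n → Graph n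
Adj    (G +ᴱ H) u v = Adj G u v ⊎ Edge H u v
dec    (G +ᴱ H) u v = dec G u v ⊎-dec decE H u v
sym    (G +ᴱ H) (_⊎_.inj₁ p) = _⊎_.inj₁ (sym G p)
sym    (G +ᴱ H) (_⊎_.inj₂ q) = _⊎_.inj₂ (symE H q)
irrefl (G +ᴱ H) (_⊎_.inj₁ p) = irrefl G p
irrefl (G +ᴱ H) (_⊎_.inj₂ q) = irreflE H q

IsClique : ∀ {n} → Graph n → Subset n → Set
IsClique G K = ∀ u v → u ∈ K → v ∈ K → u ≢ v → Adj G u v

IsMaximalClique : ∀ {n} → Graph n → Subset n → Set
IsMaximalClique G K = IsClique G K × (∀ K′ → IsClique G K′ → ¬ (K ⊂ K′))

InΛnew : ∀ {n} → Graph n → Graph n → Subset n → Set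
InΛnew G G′ K = IsMaximalClique G′ K × ¬ IsMaximalClique G K

InUnionC′ : ∀ {n} → EdgeSet n → Graph n → Subset n → Set
InUnionC′ H G′ K = ∃[ u ] ∃[ v ] (Edge H u v × u ∈ K × v ∈ K × IsMaximalClique G′ K)

-- A maximal clique of G + H containing no edge of H is a clique of G, hence
-- maximal in G, since every clique of G is a clique of G + H. Conversely a
-- clique containing an edge of H is not a clique of G, as H and E(G) are
-- disjoint. Which case occurs is decidable because H is.

module Submission where

open import Defs
open import Data.Nat using (ℕ)
open import Data.Fin.Subset using (Subset; _∈_)
open import Data.Fin.Subset.Properties using (_∈?_)
open import Data.Fin.Properties using (any?)
open import Data.Product using (_×_; _,_; ∃-syntax)
open import Data.Sum using (_⊎_; inj₁; inj₂)
open import Relation.Nullary using (Dec; yes; no; ¬_; contradiction)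
open import Relation.Nullary.Decidable using (_×-dec_)
open import Relation.Binary.PropositionalEquality using (refl)

private
  variable
    n : ℕ

ContainsEdge : EdgeSet n → Subset n → Set
ContainsEdge H K = ∃[ u ] ∃[ v ] (Edge H u v × u ∈ K × v ∈ K)

containsEdge? : (H : EdgeSet n) (K : Subset n) → Dec (ContainsEdge H K)
containsEdge? H K =
  any? λ u → any? λ v → decE H u v ×-dec (u ∈? K ×-dec v ∈? K)

IsClique-mono : (G G′ : Graph n) → (∀ {u v} → Adj G u v → Adj G′ u v) →
                ∀ {K} → IsClique G K → IsClique G′ K
IsClique-mono G G′ G⊆G′ clique u v u∈K v∈K u≢v = G⊆G′ (clique u v u∈K v∈K u≢v)

IsMaximalClique-antimono : (G G′ : Graph n) → (∀ {u v} → Adj G u v → Adj G′ u v) →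
                           ∀ {K} → IsClique G K → IsMaximalClique G′ K →
                           IsMaximalClique G K
IsMaximalClique-antimono G G′ G⊆G′ clique (_ , maximal) =
  clique , λ K′ clique′ → maximal K′ (IsClique-mono G G′ G⊆G′ clique′)

IsClique-+ᴱ-split : (G : Graph n) (H : EdgeSet n) (K : Subset n) →
                    IsClique (G +ᴱ H) K → ContainsEdge H K ⊎ IsClique G K
IsClique-+ᴱ-split G H K clique with containsEdge? H K
... | yes edge = inj₁ edge
... | no ¬edge = inj₂ cliqueG
  where
  cliqueG : IsClique G K
  cliqueG u v u∈K v∈K u≢v with clique u v u∈K v∈K u≢v
  ... | inj₁ adj  = adj
  ... | inj₂ edge = contradiction (u , v , edge , u∈K , v∈K) ¬edge

¬IsClique-ContainsEdge : (G : Graph n) (H : EdgeSet n) → Disjoint G H →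
                         ∀ {K} → ContainsEdge H K → ¬ IsClique G K
¬IsClique-ContainsEdge G H disjoint (u , v , edge , u∈K , v∈K) clique =
  disjoint u v edge (clique u v u∈K v∈K λ { refl → irreflE H edge })

lemma5 : (n : ℕ) (G : Graph n) (H : EdgeSet n) → Disjoint G H →
         ∀ (K : Subset n) →
           (InΛnew G (G +ᴱ H) K → InUnionC′ H (G +ᴱ H) K) ×
           (InUnionC′ H (G +ᴱ H) K → InΛnew G (G +ᴱ H) K)
lemma5 n G H disjoint K = new⇒union , union⇒new
  where
  new⇒union : InΛnew G (G +ᴱ H) K → InUnionC′ H (G +ᴱ H) K
  new⇒union (maximal′@(clique′ , _) , ¬maximal)
    with IsClique-+ᴱ-split G H K clique′
  ... | inj₁ (u , v , edge , u∈K , v∈K) = u , v , edge , u∈K , v∈K , maximal′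
  ... | inj₂ clique =
    contradiction (IsMaximalClique-antimono G (G +ᴱ H) inj₁ clique maximal′) ¬maximal

  union⇒new : InUnionC′ H (G +ᴱ H) K → InΛnew G (G +ᴱ H) K
  union⇒new (u , v , edge , u∈K , v∈K , maximal′) =
    maximal′ , λ (clique , _) →
      ¬IsClique-ContainsEdge G H disjoint (u , v , edge , u∈K , v∈K) clique
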